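{- Let $X$ be a set and let $\zeta=\binom{Z_i}{z_i}_{i\in I}$ be an idempotent of $\mathcal T_X$. A subset $S$ of $\mathcal T_X$ is a null semigroup with zero $\zeta$ if and only if $\zeta\in S\subseteq N(\mathbf W,\zeta)$ for some $\zeta$-system $\mathbf W$.
   Context: $\mathcal T_X$ is the semigroup of all self-maps of $X$, maps written on the right and composed left to right. The notation $\zeta=\binom{Z_i}{z_i}_{i\in I}$ means the image of $\zeta$ is $\{z_i:i\in I\}$ with the $z_i$ distinct and $z_i\zeta^{ -1}=Z_i$; since $\zeta$ is idempotent, $z_i\in Z_i$. A $\zeta$-system is a collection $\mathbf W=\{W_i: i\in I\}$ of sets with $z_i\in W_i\subseteq Z_i$ for all $i$, and $N(\mathbf W,\zeta)=\{f\in\mathcal T_X : Z_if\subseteq W_i\text{ and } W_if=\{z_i\}\text{ for all } i\in I\}$. A null semigroup with zero $z$ is a semigroup $S$ with $S^2=\{z\}$. -}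

module Defs where

open import Data.Product using (Σ; ∃; ∃-syntax; _×_; _,_)
open import Relation.Binary.PropositionalEquality using (_≡_)
open import Relation.Unary using (Pred; _∈_; _⊆_)
open import Function using (_⇔_)

-- Maps written on the right, composed left to right:  x (f ∘ₜ g) = (x f) g.
_∘ₜ_ : {X : Set} → (X → X) → (X → X) → (X → X)
(f ∘ₜ g) x = g (f x)

-- Equality of self-maps of X (pointwise; Agda has no function extensionality).
_≈_ : {X : Set} → (X → X) → (X → X) → Set
f ≈ g = ∀ x → f x ≡ g x

-- A subset of T_X: a predicate on self-maps, respecting equality of maps.
RespectsEq : {X : Set} → Pred (X → X) _ → Set
RespectsEq {X} S = ∀ {f g : X → X} → f ≈ g → f ∈ S → g ∈ S

Idempotent : {X : Set} → (X → X) → Set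
Idempotent ζ = (ζ ∘ₜ ζ) ≈ ζ

-- Index set I of ζ = (Z_i / z_i): the image points z of ζ.
-- For z in the image, Z_z = z ζ⁻¹ = { x ∣ ζ x ≡ z }.
InImage : {X : Set} → (X → X) → X → Set
InImage ζ z = ∃[ y ] ζ y ≡ z

Fiber : {X : Set} → (X → X) → X → Pred X _
Fiber ζ z x = ζ x ≡ z

-- A ζ-system: a family W_z (indexed by image points z of ζ) with z ∈ W_z ⊆ Z_z.
-- (W is given on all of X but only its values at image points matter.)
IsSystem : {X : Set} → (X → X) → (X → Pred X _) → Set
IsSystem {X} ζ W = ∀ (z : X) → InImage ζ z → (z ∈ W z) × (W z ⊆ Fiber ζ z)

ImageIsSingleton : {X : Set} → (X → X) → Pred X _ → X → Set
ImageIsSingleton {X} f A z = ∀ (y : X) → (∃[ x ] (x ∈ A × f x ≡ y)) ⇔ (y ≡ z)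

N : {X : Set} → (X → Pred X _) → (X → X) → Pred (X → X) _
N {X} W ζ f = ∀ (z : X) → InImage ζ z →
  (∀ x → x ∈ Fiber ζ z → f x ∈ W z) × ImageIsSingleton f (W z) z

-- S is a null semigroup with zero ζ: S ⊆ T_X closed under composition
-- with S² = {ζ}, i.e. ζ ∈ S and every product of two elements of S is ζ.
-- (ζ ∈ S together with ζζ = ζ makes ζ a product, so S² = {ζ} exactly;
--  closure under composition follows since products equal ζ ∈ S.)
IsNullSemigroupWithZero : {X : Set} → Pred (X → X) _ → (X → X) → Set
IsNullSemigroupWithZero {X} S ζ =
  (ζ ∈ S) × (∀ (f g : X → X) → f ∈ S → g ∈ S → (f ∘ₜ g) ∈ S × (f ∘ₜ g) ≈ ζ)

-- For the forward direction take W_i = Z_i S, the union of the images of Z_i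
-- under the members of S: since fζ = ζ for f ∈ S it lies inside Z_i, it
-- contains z_i = z_i ζ, and Z_i S f ⊆ Z_i S² = {z_i}. Conversely, for f, g in
-- N(W, ζ) and x ∈ Z_i we get x f ∈ W_i and hence x f g = z_i = x ζ, so S² = {ζ}.
module Submission where

open import Defs
open import Level using (0ℓ)
open import Data.Product using (∃-syntax; _×_; _,_; proj₁; proj₂)
open import Relation.Unary using (Pred; _∈_; _⊆_)
open import Function using (_⇔_; mk⇔; Equivalence)
open import Relation.Binary.PropositionalEquality using (_≡_; refl; sym; cong)
open Relation.Binary.PropositionalEquality.≡-Reasoning

imageIsSingleton : ∀ {X : Set} {f : X → X} {A : Pred X 0ℓ} {z} →
  z ∈ A → f z ≡ z → (∀ x → x ∈ A → f x ≡ z) → ImageIsSingleton f A z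
imageIsSingleton z∈A fz≡z A↦z y = mk⇔
  (λ { (x , x∈A , refl) → A↦z x x∈A })
  (λ { refl → _ , z∈A , fz≡z })

module _ {X : Set} {ζ : X → X} where

  idempotent-fixes-image : Idempotent ζ → ∀ {z} → InImage ζ z → ζ z ≡ z
  idempotent-fixes-image idem (y , refl) = idem y

  image-fiber : ∀ x → InImage ζ (ζ x)
  image-fiber x = x , refl

  fiberImage : Pred (X → X) 0ℓ → X → Pred X 0ℓ
  fiberImage S z x = ∃[ f ] (f ∈ S × ∃[ y ] (y ∈ Fiber ζ z × f y ≡ x))

  N-product≈ζ : ∀ {W f g} → f ∈ N W ζ → g ∈ N W ζ → (f ∘ₜ g) ≈ ζ
  N-product≈ζ {g = g} fN gN x =
    Equivalence.to (proj₂ (gN (ζ x) (image-fiber x)) (g _))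
      (_ , proj₁ (fN (ζ x) (image-fiber x)) x refl , refl)

  nullSemigroup-from-products : ∀ {S : Pred (X → X) 0ℓ} → RespectsEq S → ζ ∈ S →
    (∀ {f g} → f ∈ S → g ∈ S → (f ∘ₜ g) ≈ ζ) → IsNullSemigroupWithZero S ζ
  nullSemigroup-from-products resp ζ∈S product≈ζ = ζ∈S , λ f g f∈S g∈S →
    resp (λ x → sym (product≈ζ f∈S g∈S x)) ζ∈S , product≈ζ f∈S g∈S

  module _ (idem : Idempotent ζ) {S : Pred (X → X) 0ℓ}
           (null : IsNullSemigroupWithZero S ζ) where

    private
      ζ∈S : ζ ∈ S
      ζ∈S = proj₁ null

      product≈ζ : ∀ {f g} → f ∈ S → g ∈ S → (f ∘ₜ g) ≈ ζ
      product≈ζ {f} {g} f∈S g∈S = proj₂ (proj₂ null f g f∈S g∈S)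

    z∈fiberImage : ∀ {z} → InImage ζ z → z ∈ fiberImage S z
    z∈fiberImage im = ζ , ζ∈S , _ , idempotent-fixes-image idem im , idempotent-fixes-image idem im

    fiberImage-isSystem : IsSystem ζ (fiberImage S)
    fiberImage-isSystem z im =
      z∈fiberImage im , λ { (f , f∈S , y , refl , refl) → product≈ζ f∈S ζ∈S y }

    null⊆N : S ⊆ N (fiberImage S) ζ
    null⊆N {f} f∈S z im =
      (λ x x∈Z → f , f∈S , x , x∈Z , refl) ,
      imageIsSingleton (z∈fiberImage im) fz≡z
        (λ { _ (g , g∈S , y , refl , refl) → product≈ζ g∈S f∈S y })
      where
      fz≡z : f z ≡ z
      fz≡z = begin
        f z      ≡⟨ cong f (sym (idempotent-fixes-image idem im)) ⟩
        f (ζ z)  ≡⟨ product≈ζ ζ∈S f∈S z ⟩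
        ζ z      ≡⟨ idempotent-fixes-image idem im ⟩
        z        ∎

lemma4p2 : (X : Set) (ζ : X → X) → Idempotent ζ →
    (S : Pred (X → X) _) → RespectsEq S →
    IsNullSemigroupWithZero S ζ ⇔ (∃[ W ] (IsSystem ζ W × ζ ∈ S × S ⊆ N W ζ))
lemma4p2 X ζ idem S resp = mk⇔
  (λ null → fiberImage S , fiberImage-isSystem idem null , proj₁ null , λ {f} → null⊆N idem null {f})
  (λ { (W , _ , ζ∈S , S⊆N) → nullSemigroup-from-products resp ζ∈S
                                 (λ f∈S g∈S → N-product≈ζ (S⊆N f∈S) (S⊆N g∈S)) })
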